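{- Let $k$ be a positive integer and $b=3k+1$. Then $S_{x^3,b}$ has at least $5$ distinct cycles.
   Context: For an integer $b\ge2$, $S_{x^3,b}(n)=x_0^3+\dots+x_d^3$ where $n=x_0+x_1b+\dots+x_db^d$ is the base-$b$ expansion of $n\ge0$. A cycle of $S_{x^3,b}$ is a sequence of pairwise distinct positive integers $\mathrm{cyc}(n_1,\dots,n_\ell)$ with $S_{x^3,b}(n_i)=n_{i+1}$ ($1\le i<\ell$) and $S_{x^3,b}(n_\ell)=n_1$, considered up to cyclic permutation. -}

module Defs where

open import Data.Nat using (ℕ; zero; suc; _+_; _*_; _^_; _<_; NonZero)
open import Data.Nat.DivMod using (_/_; _%_)
open import Data.Nat.ListAction using (sum)
open import Data.List using (List; []; _∷_; map; length; drop; take; _++_)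
open import Data.List.Relation.Unary.All using (All)
open import Data.List.Relation.Unary.Unique.Propositional using (Unique)
open import Data.List.Relation.Unary.Linked using (Linked)
open import Data.List.Relation.Unary.AllPairs using (AllPairs)
open import Data.Product using (_×_; Σ; ∃)
open import Data.Empty using (⊥)
open import Relation.Binary.PropositionalEquality using (_≡_)
open import Relation.Nullary using (¬_)

-- Base-b digits of n, least significant first (x_0, x_1, ..., x_d).
-- The first argument is fuel; fuel n suffices for n since n / b < n when n > 0, b ≥ 2.
digitsAux : (b : ℕ) → .{{NonZero b}} → ℕ → ℕ → List ℕ
digitsAux b zero    n       = []
digitsAux b (suc f) zero    = []
digitsAux b (suc f) (suc n) = (suc n % b) ∷ digitsAux b f (suc n / b)

digits : (b : ℕ) → {{NonZero b}} → ℕ → List ℕ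
digits b n = digitsAux b n n

Scube : (b : ℕ) → {{NonZero b}} → ℕ → ℕ
Scube b n = sum (map (λ x → x ^ 3) (digits b n))

lastOf : ℕ → List ℕ → ℕ
lastOf x []       = x
lastOf x (y ∷ ys) = lastOf y ys

IsCycle : (ℕ → ℕ) → List ℕ → Set
IsCycle f []       = ⊥
IsCycle f (x ∷ xs) =
  All (λ n → 0 < n) (x ∷ xs) × Unique (x ∷ xs) ×
  Linked (λ m n → f m ≡ n) (x ∷ xs) × f (lastOf x xs) ≡ x

rotate : ℕ → List ℕ → List ℕ
rotate i xs = drop i xs ++ take i xs

SameCycle : List ℕ → List ℕ → Set
SameCycle xs ys = Σ ℕ (λ i → i < length xs × rotate i xs ≡ ys)

AtLeastCycles : ℕ → (ℕ → ℕ) → Set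
AtLeastCycles m f =
  Σ (List (List ℕ)) (λ cs →
    length cs ≡ m × All (IsCycle f) cs × AllPairs (λ c d → ¬ SameCycle c d) cs)

-- With y = 2m + 1, the numbers written (0, y, m), (1, y, m) and (y, 0, m + 1) in base
-- b = 3m + 1 (least significant digit first) are fixed points of S, as is 1, and none of
-- these four is divisible by 3. Since b ≡ 1 and x³ ≡ x (mod 3), S(n) ≡ n (mod 3); and a
-- number below b⁴ has at most four digits, each at most b − 1, so S(n) ≤ 4(b − 1)³ < b⁴.
-- Hence S maps the finite set of positive multiples of 3 below b⁴ into itself, so the
-- orbit of 3 becomes periodic there, and its minimal period gives a fifth cycle.

module Submission where

open import Defs
open import Data.Nat using (ℕ; zero; suc; pred; _+_; _*_; _^_; _∸_; _<_; _≤_; _≟_; _<?_; z≤n; s≤s; z<s; NonZero)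
open import Data.Nat.Properties
open import Data.Nat.DivMod
open import Data.Nat.Divisibility using (divides)
open import Data.Nat.GeneralisedArithmetic using (fold; fold-+)
open import Data.Nat.Induction using (<-wellFounded)
open import Data.Nat.ListAction using (sum)
open import Data.Nat.Tactic.RingSolver using (solve-∀)
open import Data.List using (List; []; _∷_; map; length; applyUpTo)
open import Data.List.Properties using (∷-injectiveˡ)
open import Data.List.Relation.Unary.All as All using (All; []; _∷_)
import Data.List.Relation.Unary.All.Properties as Allₚ
open import Data.List.Relation.Unary.AllPairs using ([]; _∷_)
open import Data.List.Relation.Unary.Linked using ([-])
import Data.List.Relation.Unary.Linked.Properties as Linked
import Data.List.Relation.Unary.Unique.Propositional.Properties as Unique
open import Data.Fin using (toℕ; fromℕ<)
open import Data.Fin.Properties using (pigeonhole; toℕ-fromℕ<)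
open import Data.Product using (∃; _×_; _,_; proj₁; proj₂)
open import Function using (case_of_)
open import Induction.WellFounded using (Acc; acc)
open import Relation.Nullary using (¬_; yes; no)
open import Relation.Nullary.Decidable using (_×-dec_)
open import Relation.Unary using (Pred; Decidable)
open import Relation.Binary.PropositionalEquality

least-witness : ∀ {ℓ} {P : Pred ℕ ℓ} → Decidable P → ∀ {n} → P n →
                ∃ λ m → P m × (∀ {k} → k < m → ¬ P k)
least-witness {P = P} P? {n} = go n (<-wellFounded n)
  where
  go : ∀ n → Acc _<_ n → P n → ∃ λ m → P m × (∀ {k} → k < m → ¬ P k)
  go n (acc smaller) Pn with anyUpTo? P? n
  ... | yes (m , m<n , Pm) = go m (smaller m<n) Pm
  ... | no none            = n , Pn , λ k<n Pk → none (_ , k<n , Pk)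

lastOf-applyUpTo : ∀ (g : ℕ → ℕ) n → lastOf (g 0) (applyUpTo (λ i → g (suc i)) n) ≡ g n
lastOf-applyUpTo g zero    = refl
lastOf-applyUpTo g (suc n) = lastOf-applyUpTo (λ i → g (suc i)) n

module _ (f : ℕ → ℕ) where

  IsPeriod : ℕ → ℕ → Set
  IsPeriod y p = 0 < p × fold y f p ≡ y

  isPeriod? : ∀ y → Decidable (IsPeriod y)
  isPeriod? y p = (0 <? p) ×-dec (fold y f p ≟ y)

  repeat⇒isPeriod : ∀ {x i j} → i < j → fold x f i ≡ fold x f j → IsPeriod (fold x f i) (j ∸ i)
  repeat⇒isPeriod {x} {i} {j} i<j fi≡fj = m<n⇒0<n∸m i<j , (begin
    fold (fold x f i) f (j ∸ i) ≡⟨ fold-+ x f (j ∸ i) ⟨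
    fold x f (j ∸ i + i)        ≡⟨ cong (fold x f) (m∸n+n≡m (<⇒≤ i<j)) ⟩
    fold x f j                  ≡⟨ fi≡fj ⟨
    fold x f i                  ∎)
    where open ≡-Reasoning

  orbit-injective : ∀ {y p} → IsPeriod y p → (∀ {e} → e < p → ¬ IsPeriod y e) →
                    ∀ {i j} → i < j → j < p → fold y f i ≢ fold y f j
  orbit-injective {y} {p} (_ , fp≡y) minimal {i} {j} i<j j<p fi≡fj =
    minimal (subst (p ∸ j + i <_) p∸j+j≡p (+-monoʳ-< (p ∸ j) i<j))
            (<-≤-trans (m<n⇒0<n∸m j<p) (m≤m+n (p ∸ j) i) , returns)
    where
    open ≡-Reasoning
    p∸j+j≡p : p ∸ j + j ≡ p
    p∸j+j≡p = m∸n+n≡m (<⇒≤ j<p)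
    returns : fold y f (p ∸ j + i) ≡ y
    returns = begin
      fold y f (p ∸ j + i)        ≡⟨ fold-+ y f (p ∸ j) ⟩
      fold (fold y f i) f (p ∸ j) ≡⟨ cong (λ z → fold z f (p ∸ j)) fi≡fj ⟩
      fold (fold y f j) f (p ∸ j) ≡⟨ fold-+ y f (p ∸ j) ⟨
      fold y f (p ∸ j + j)        ≡⟨ cong (fold y f) p∸j+j≡p ⟩
      fold y f p                  ≡⟨ fp≡y ⟩
      y                           ∎

  minimal-period⇒isCycle : ∀ {y p} → (∀ i → 0 < fold y f i) → IsPeriod y p →
                           (∀ {e} → e < p → ¬ IsPeriod y e) → IsCycle f (applyUpTo (fold y f) p)
  minimal-period⇒isCycle {y} {suc n} positive period@(_ , fp≡y) minimal =
    Allₚ.applyUpTo⁺₂ (fold y f) (suc n) positive ,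
    Unique.applyUpTo⁺₁ (fold y f) (suc n) (orbit-injective period minimal) ,
    Linked.applyUpTo⁺₂ (fold y f) (suc n) (λ _ → refl) ,
    trans (cong f (lastOf-applyUpTo (fold y f) n)) fp≡y

  module _ {ℓ} {P : Pred ℕ ℓ} (invariant : ∀ {x} → P x → P (f x)) where

    fold-invariant : ∀ {x} → P x → ∀ i → P (fold x f i)
    fold-invariant Px zero    = Px
    fold-invariant Px (suc i) = invariant (fold-invariant Px i)

    periodic-point : ∀ {B} → (∀ {x} → P x → x < B) → ∀ {x} → P x → ∃ λ y → P y × ∃ (IsPeriod y)
    periodic-point {B} bounded {x} Px
      with i , j , i<j , same ← pigeonhole (n<1+n B) (λ t → fromℕ< (bounded (fold-invariant Px (toℕ t))))
      = fold x f (toℕ i) , fold-invariant Px (toℕ i) , _ ,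
        repeat⇒isPeriod i<j (trans (sym (toℕ-fromℕ< _)) (trans (cong toℕ same) (toℕ-fromℕ< _)))

    bounded-invariant⇒cycle : ∀ {B} → (∀ {x} → P x → x < B) → (∀ {x} → P x → 0 < x) →
                              ∀ {x} → P x → ∃ λ c → IsCycle f c × All P c
    bounded-invariant⇒cycle bounded positive Px =
      let y , Py , _ , period      = periodic-point bounded Px
          p , period′ , minimal   = least-witness (isPeriod? y) period
      in applyUpTo (fold y f) p ,
         minimal-period⇒isCycle (λ i → positive (fold-invariant Py i)) period′ minimal ,
         Allₚ.applyUpTo⁺₂ (fold y f) p (fold-invariant Py)

fixed-point⇒isCycle : ∀ {f n} → 0 < n → f n ≡ n → IsCycle f (n ∷ [])
fixed-point⇒isCycle 0<n fn≡n = 0<n ∷ [] , [] ∷ [] , [-] , fn≡n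

singleton-SameCycle : ∀ {u ys} → SameCycle (u ∷ []) ys → ys ≡ u ∷ []
singleton-SameCycle (zero , _ , rotation) = sym rotation
singleton-SameCycle (suc _ , s≤s () , _)

distinct-fixed-points : ∀ {u v} → u ≢ v → ¬ SameCycle (u ∷ []) (v ∷ [])
distinct-fixed-points u≢v same = u≢v (sym (∷-injectiveˡ (singleton-SameCycle same)))

fixed-point-outside : ∀ {ℓ} {P : Pred ℕ ℓ} {u c} → ¬ P u → All P c → ¬ SameCycle (u ∷ []) c
fixed-point-outside ¬Pu Pc same with refl ← singleton-SameCycle same | Pu ∷ [] ← Pc = ¬Pu Pu

-- A proof of a ≡ c [mod q] is an equation between remainders, from which a and c cannot
-- be inferred; the lemmas below are therefore often given them explicitly.
infix 4 _≡_[mod_]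
_≡_[mod_] : ℕ → ℕ → (q : ℕ) → {{NonZero q}} → Set
a ≡ c [mod q ] = a % q ≡ c % q

module _ {q : ℕ} {{_ : NonZero q}} where

  +-cong-mod : ∀ {a a′ c c′} → a ≡ a′ [mod q ] → c ≡ c′ [mod q ] → a + c ≡ a′ + c′ [mod q ]
  +-cong-mod {a} {a′} {c} {c′} a≡a′ c≡c′ = begin
    (a + c) % q               ≡⟨ %-distribˡ-+ a c q ⟩
    (a % q + c % q) % q       ≡⟨ cong₂ (λ u v → (u + v) % q) a≡a′ c≡c′ ⟩
    (a′ % q + c′ % q) % q     ≡⟨ %-distribˡ-+ a′ c′ q ⟨
    (a′ + c′) % q             ∎
    where open ≡-Reasoning

  *-cong-mod : ∀ {a a′ c c′} → a ≡ a′ [mod q ] → c ≡ c′ [mod q ] → a * c ≡ a′ * c′ [mod q ]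
  *-cong-mod {a} {a′} {c} {c′} a≡a′ c≡c′ = begin
    (a * c) % q               ≡⟨ %-distribˡ-* a c q ⟩
    (a % q * (c % q)) % q     ≡⟨ cong₂ (λ u v → (u * v) % q) a≡a′ c≡c′ ⟩
    (a′ % q * (c′ % q)) % q   ≡⟨ %-distribˡ-* a′ c′ q ⟨
    (a′ * c′) % q             ∎
    where open ≡-Reasoning

^-cong-mod : ∀ {q} {{_ : NonZero q}} {a a′} → a ≡ a′ [mod q ] → ∀ n → a ^ n ≡ a′ ^ n [mod q ]
^-cong-mod                a≡a′ zero    = refl
^-cong-mod {a = a} {a′} a≡a′ (suc n) = *-cong-mod {a = a} {a′} {a ^ n} {a′ ^ n} a≡a′ (^-cong-mod a≡a′ n)

cube≡-mod3 : ∀ x → x ^ 3 ≡ x [mod 3 ]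
cube≡-mod3 x = begin
  x ^ 3 % 3        ≡⟨ ^-cong-mod {a = x} {x % 3} (sym (m%n%n≡m%n x 3)) 3 ⟩
  (x % 3) ^ 3 % 3  ≡⟨ small-cube (m%n<n x 3) ⟩
  x % 3 % 3        ≡⟨ m%n%n≡m%n x 3 ⟩
  x % 3            ∎
  where
  open ≡-Reasoning
  small-cube : ∀ {r} → r < 3 → r ^ 3 % 3 ≡ r % 3
  small-cube {0} _ = refl
  small-cube {1} _ = refl
  small-cube {2} _ = refl
  small-cube {suc (suc (suc _))} (s≤s (s≤s (s≤s ())))

≡r+t*q⇒%≡r : ∀ {n q} {{_ : NonZero q}} r t → r < q → n ≡ r + t * q → n % q ≡ r
≡r+t*q⇒%≡r {q = q} r t r<q refl = trans ([m+kn]%n≡m%n r t q) (m<n⇒m%n≡m r<q)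

cubeSum : List ℕ → ℕ
cubeSum xs = sum (map (_^ 3) xs)

cubeSum≡sum-mod3 : ∀ xs → cubeSum xs ≡ sum xs [mod 3 ]
cubeSum≡sum-mod3 []       = refl
cubeSum≡sum-mod3 (x ∷ xs) = +-cong-mod {a = x ^ 3} {x} {cubeSum xs} {sum xs} (cube≡-mod3 x) (cubeSum≡sum-mod3 xs)

cubeSum-≤ : ∀ {c xs} → All (_≤ c) xs → cubeSum xs ≤ length xs * c ^ 3
cubeSum-≤ []         = z≤n
cubeSum-≤ (x≤c ∷ xs) = +-mono-≤ (^-monoˡ-≤ 3 x≤c) (cubeSum-≤ xs)

4*c^3<[1+c]^4 : ∀ c → 4 * c ^ 3 < suc c ^ 4
4*c^3<[1+c]^4 c = subst (4 * c ^ 3 <_) (sym (binomial c)) (s≤s (m≤m+n (4 * c ^ 3) _))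
  where
  binomial : ∀ c → suc c * (suc c * (suc c * (suc c * 1))) ≡
                   suc (4 * (c * (c * (c * 1))) + (c * (c * (c * c)) + 6 * (c * c) + 4 * c))
  binomial = solve-∀

module Digits (b : ℕ) {{_ : NonZero b}} (1<b : 1 < b) where

  fromDigits : List ℕ → ℕ
  fromDigits []       = 0
  fromDigits (x ∷ xs) = x + b * fromDigits xs

  quotient-≤ : ∀ {n f} → suc n ≤ suc f → suc n / b ≤ f
  quotient-≤ {n} n<f = ≤-pred (≤-trans (m/n<m (suc n) b 1<b) n<f)

  digitsAux-fuel : ∀ {f g n} → n ≤ f → n ≤ g → digitsAux b f n ≡ digitsAux b g n
  digitsAux-fuel {zero}  {zero}  {zero}  _ _ = refl
  digitsAux-fuel {zero}  {suc _} {zero}  _ _ = refl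
  digitsAux-fuel {suc _} {zero}  {zero}  _ _ = refl
  digitsAux-fuel {suc _} {suc _} {zero}  _ _ = refl
  digitsAux-fuel {suc f} {suc g} {suc n} n≤f n≤g =
    cong (suc n % b ∷_) (digitsAux-fuel (quotient-≤ n≤f) (quotient-≤ n≤g))

  digits-step : ∀ {n} → 0 < n → digits b n ≡ n % b ∷ digits b (n / b)
  digits-step {suc n} _ = cong (suc n % b ∷_) (digitsAux-fuel (quotient-≤ ≤-refl) ≤-refl)

  fromDigits-digitsAux : ∀ f {n} → n ≤ f → fromDigits (digitsAux b f n) ≡ n
  fromDigits-digitsAux zero    {zero}  _   = refl
  fromDigits-digitsAux (suc f) {zero}  _   = refl
  fromDigits-digitsAux (suc f) {suc n} n≤f = begin
    suc n % b + b * fromDigits (digitsAux b f (suc n / b)) ≡⟨ cong (λ t → suc n % b + b * t) (fromDigits-digitsAux f (quotient-≤ n≤f)) ⟩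
    suc n % b + b * (suc n / b)                            ≡⟨ cong (suc n % b +_) (*-comm b (suc n / b)) ⟩
    suc n % b + suc n / b * b                              ≡⟨ m≡m%n+[m/n]*n (suc n) b ⟨
    suc n                                                  ∎
    where open ≡-Reasoning

  fromDigits-digits : ∀ n → fromDigits (digits b n) ≡ n
  fromDigits-digits n = fromDigits-digitsAux n ≤-refl

  digitsAux-< : ∀ f n → All (_< b) (digitsAux b f n)
  digitsAux-< zero    n       = []
  digitsAux-< (suc f) zero    = []
  digitsAux-< (suc f) (suc n) = m%n<n (suc n) b ∷ digitsAux-< f (suc n / b)

  length-digitsAux : ∀ f {n j} → n < b ^ j → length (digitsAux b f n) ≤ j
  length-digitsAux zero    _ = z≤n
  length-digitsAux (suc f) {zero}           _ = z≤n
  length-digitsAux (suc f) {suc n} {suc j} n<b^j =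
    s≤s (length-digitsAux f (m<n*o⇒m/o<n (subst (suc n <_) (*-comm b (b ^ j)) n<b^j)))
  length-digitsAux (suc f) {suc n} {zero}  (s≤s ())

  positive-cons : ∀ {x r} → 0 < r → 0 < x + b * r
  positive-cons {x} {r} 0<r = <-≤-trans 0<r (≤-trans (m≤n*m r b) (m≤n+m (b * r) x))

  digits-cons : ∀ {x r} → x < b → 0 < r → digits b (x + b * r) ≡ x ∷ digits b r
  digits-cons {x} {r} x<b 0<r = begin
    digits b (x + b * r)                                    ≡⟨ digits-step (positive-cons 0<r) ⟩
    (x + b * r) % b ∷ digits b ((x + b * r) / b)            ≡⟨ cong₂ (λ u v → u ∷ digits b v) remainder quotient ⟩
    x ∷ digits b r                                          ∎
    where
    open ≡-Reasoning
    x+r*b : x + b * r ≡ x + r * b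
    x+r*b = cong (x +_) (*-comm b r)
    remainder : (x + b * r) % b ≡ x
    remainder = trans (cong (_% b) x+r*b) (trans ([m+kn]%n≡m%n x r b) (m<n⇒m%n≡m x<b))
    quotient : (x + b * r) / b ≡ r
    quotient = begin
      (x + b * r) / b     ≡⟨ cong (_/ b) x+r*b ⟩
      (x + r * b) / b     ≡⟨ +-distrib-/-∣ʳ x (divides r refl) ⟩
      x / b + r * b / b   ≡⟨ cong₂ _+_ (m<n⇒m/n≡0 x<b) (m*n/n≡m r b) ⟩
      r                   ∎

  digits-digit : ∀ {x} → 0 < x → x < b → digits b x ≡ x ∷ []
  digits-digit {x} 0<x x<b =
    trans (digits-step 0<x) (cong₂ (λ u v → u ∷ digits b v) (m<n⇒m%n≡m x<b) (m<n⇒m/n≡0 x<b))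

  cubeSum≡0⇒fromDigits≡0 : ∀ xs → cubeSum xs ≡ 0 → fromDigits xs ≡ 0
  cubeSum≡0⇒fromDigits≡0 []           _  = refl
  cubeSum≡0⇒fromDigits≡0 (zero ∷ xs)  eq = trans (cong (b *_) (cubeSum≡0⇒fromDigits≡0 xs eq)) (*-zeroʳ b)

  Scube-positive : ∀ {n} → 0 < n → 0 < Scube b n
  Scube-positive {n} 0<n = n≢0⇒n>0 λ S≡0 →
    >⇒≢ 0<n (trans (sym (fromDigits-digits n)) (cubeSum≡0⇒fromDigits≡0 (digits b n) S≡0))

  Scube-<-b^4 : ∀ {n} → n < b ^ 4 → Scube b n < b ^ 4
  Scube-<-b^4 {n} n<b^4 = begin-strict
    Scube b n                   ≤⟨ cubeSum-≤ (All.map <⇒≤pred (digitsAux-< n n)) ⟩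
    length (digits b n) * c ^ 3 ≤⟨ *-monoˡ-≤ (c ^ 3) (length-digitsAux n {j = 4} n<b^4) ⟩
    4 * c ^ 3                   <⟨ 4*c^3<[1+c]^4 c ⟩
    suc c ^ 4                   ≡⟨ cong (_^ 4) (suc-pred b) ⟩
    b ^ 4                       ∎
    where
    open ≤-Reasoning
    c : ℕ
    c = pred b

  fromDigits≡sum-mod : ∀ {q} {{_ : NonZero q}} → b ≡ 1 [mod q ] → ∀ xs → fromDigits xs ≡ sum xs [mod q ]
  fromDigits≡sum-mod b≡1 []       = refl
  fromDigits≡sum-mod {q} b≡1 (x ∷ xs) =
    +-cong-mod {a = x} {x} {b * fromDigits xs} {sum xs} refl
      (trans (*-cong-mod {a = b} {1} {fromDigits xs} {sum xs} b≡1 (fromDigits≡sum-mod b≡1 xs))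
             (cong (_% q) (*-identityˡ (sum xs))))

  Scube≡-mod3 : b ≡ 1 [mod 3 ] → ∀ n → Scube b n ≡ n [mod 3 ]
  Scube≡-mod3 b≡1 n = begin
    Scube b n % 3                ≡⟨ cubeSum≡sum-mod3 (digits b n) ⟩
    sum (digits b n) % 3         ≡⟨ fromDigits≡sum-mod b≡1 (digits b n) ⟨
    fromDigits (digits b n) % 3  ≡⟨ cong (_% 3) (fromDigits-digits n) ⟩
    n % 3                        ∎
    where open ≡-Reasoning

  digits-three : ∀ {x y z} → x < b → y < b → 0 < z → z < b → digits b (x + b * (y + b * z)) ≡ x ∷ y ∷ z ∷ []
  digits-three {x} {y} {z} x<b y<b 0<z z<b = begin
    digits b (x + b * (y + b * z)) ≡⟨ digits-cons x<b (positive-cons 0<z) ⟩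
    x ∷ digits b (y + b * z)       ≡⟨ cong (x ∷_) (digits-cons y<b 0<z) ⟩
    x ∷ y ∷ digits b z             ≡⟨ cong (λ zs → x ∷ y ∷ zs) (digits-digit 0<z z<b) ⟩
    x ∷ y ∷ z ∷ []                 ∎
    where open ≡-Reasoning

  three-digit-fixed-point : ∀ {x y z} → x < b → y < b → 0 < z → z < b →
                            x ^ 3 + (y ^ 3 + (z ^ 3 + 0)) ≡ x + b * (y + b * z) →
                            IsCycle (Scube b) (x + b * (y + b * z) ∷ [])
  three-digit-fixed-point x<b y<b 0<z z<b cubes≡value =
    fixed-point⇒isCycle (positive-cons (positive-cons 0<z))
      (trans (cong cubeSum (digits-three x<b y<b 0<z z<b)) cubes≡value)

module Base3m+1 (k : ℕ) where

  m b y : ℕ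
  m = suc k
  b = 3 * m + 1
  y = 2 * m + 1

  3<b : 3 < b
  3<b = subst (3 <_) (sym (b≡4+3k k)) (s≤s (s≤s (s≤s (s≤s z≤n))))
    where
    b≡4+3k : ∀ k → 3 * suc k + 1 ≡ 4 + 3 * k
    b≡4+3k = solve-∀

  1<b : 1 < b
  1<b = <-trans (s≤s (s≤s z≤n)) 3<b

  open Digits b 1<b

  b≡1-mod3 : b ≡ 1 [mod 3 ]
  b≡1-mod3 = ≡r+t*q⇒%≡r 1 m (s≤s (s≤s z≤n)) (b≡1+3m m)
    where
    b≡1+3m : ∀ m → 3 * m + 1 ≡ 1 + m * 3
    b≡1+3m = solve-∀

  y<b : y < b
  y<b = subst (y <_) (sym (b≡y+m m)) (m<m+n y z<s)
    where
    b≡y+m : ∀ m → 3 * m + 1 ≡ (2 * m + 1) + m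
    b≡y+m = solve-∀

  1+m<b : suc m < b
  1+m<b = subst (suc m <_) (sym (b≡1+m+2m m)) (m<m+n (suc m) z<s)
    where
    b≡1+m+2m : ∀ m → 3 * m + 1 ≡ suc m + 2 * m
    b≡1+m+2m = solve-∀

  m<b : m < b
  m<b = <-trans (n<1+n m) 1+m<b

  A B C : ℕ
  A = 0 + b * (y + b * m)
  B = 1 + b * (y + b * m)
  C = y + b * (0 + b * suc m)

  digits-1 : digits b 1 ≡ 1 ∷ []
  digits-1 = digits-digit z<s 1<b

  digits-A : digits b A ≡ 0 ∷ y ∷ m ∷ []
  digits-A = digits-three z<s y<b z<s m<b

  digits-B : digits b B ≡ 1 ∷ y ∷ m ∷ []
  digits-B = digits-three 1<b y<b z<s m<b

  digits-C : digits b C ≡ y ∷ 0 ∷ suc m ∷ []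
  digits-C = digits-three y<b z<s z<s 1+m<b

  distinct-digits : ∀ {u v xs ys} → digits b u ≡ xs → digits b v ≡ ys → xs ≢ ys →
                    ¬ SameCycle (u ∷ []) (v ∷ [])
  distinct-digits du dv xs≢ys = distinct-fixed-points λ u≡v →
    xs≢ys (trans (sym du) (trans (cong (digits b) u≡v) dv))

  SmallMultipleOf3 : Pred ℕ _
  SmallMultipleOf3 n = 0 < n × n % 3 ≡ 0 × n < b ^ 4

  Scube-preserves : ∀ {n} → SmallMultipleOf3 n → SmallMultipleOf3 (Scube b n)
  Scube-preserves {n} (0<n , n%3≡0 , n<b^4) =
    Scube-positive 0<n , trans (Scube≡-mod3 b≡1-mod3 n) n%3≡0 , Scube-<-b^4 n<b^4

  small-multiple-3 : SmallMultipleOf3 3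
  small-multiple-3 = z<s , refl , <-≤-trans 3<b (subst (_≤ b ^ 4) (*-identityʳ b) (^-monoʳ-≤ b {1} {4} (s≤s z≤n)))

  ¬SmallMultipleOf3 : ∀ {n r} → n % 3 ≡ suc r → ¬ SmallMultipleOf3 n
  ¬SmallMultipleOf3 n%3≡1+r (_ , n%3≡0 , _) = case trans (sym n%3≡1+r) n%3≡0 of λ ()

  A%3≡1 : A % 3 ≡ 1
  A%3≡1 = ≡r+t*q⇒%≡r 1 (3 * m * m * m + 4 * m * m + 2 * m) (s≤s (s≤s z≤n)) (A≡1+3t m)
    where
    A≡1+3t : ∀ m → 0 + (3 * m + 1) * ((2 * m + 1) + (3 * m + 1) * m) ≡ 1 + (3 * m * m * m + 4 * m * m + 2 * m) * 3
    A≡1+3t = solve-∀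

  B%3≡2 : B % 3 ≡ 2
  B%3≡2 = ≡r+t*q⇒%≡r 2 (3 * m * m * m + 4 * m * m + 2 * m) (s≤s (s≤s (s≤s z≤n))) (B≡2+3t m)
    where
    B≡2+3t : ∀ m → 1 + (3 * m + 1) * ((2 * m + 1) + (3 * m + 1) * m) ≡ 2 + (3 * m * m * m + 4 * m * m + 2 * m) * 3
    B≡2+3t = solve-∀

  C%3≡2 : C % 3 ≡ 2
  C%3≡2 = ≡r+t*q⇒%≡r 2 (3 * m * m * m + 5 * m * m + 3 * m) (s≤s (s≤s (s≤s z≤n))) (C≡2+3t m)
    where
    C≡2+3t : ∀ m → (2 * m + 1) + (3 * m + 1) * (0 + (3 * m + 1) * suc m) ≡ 2 + (3 * m * m * m + 5 * m * m + 3 * m) * 3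
    C≡2+3t = solve-∀

  isCycle-1 : IsCycle (Scube b) (1 ∷ [])
  isCycle-1 = fixed-point⇒isCycle z<s (cong cubeSum digits-1)

  isCycle-A : IsCycle (Scube b) (A ∷ [])
  isCycle-A = three-digit-fixed-point z<s y<b z<s m<b (cubes≡value m)
    where
    cubes≡value : ∀ m → 0 * (0 * (0 * 1)) + ((2 * m + 1) * ((2 * m + 1) * ((2 * m + 1) * 1)) + (m * (m * (m * 1)) + 0)) ≡
                        0 + (3 * m + 1) * ((2 * m + 1) + (3 * m + 1) * m)
    cubes≡value = solve-∀

  isCycle-B : IsCycle (Scube b) (B ∷ [])
  isCycle-B = three-digit-fixed-point 1<b y<b z<s m<b (cubes≡value m)
    where
    cubes≡value : ∀ m → 1 * (1 * (1 * 1)) + ((2 * m + 1) * ((2 * m + 1) * ((2 * m + 1) * 1)) + (m * (m * (m * 1)) + 0)) ≡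
                        1 + (3 * m + 1) * ((2 * m + 1) + (3 * m + 1) * m)
    cubes≡value = solve-∀

  isCycle-C : IsCycle (Scube b) (C ∷ [])
  isCycle-C = three-digit-fixed-point y<b z<s z<s 1+m<b (cubes≡value m)
    where
    cubes≡value : ∀ m → (2 * m + 1) * ((2 * m + 1) * ((2 * m + 1) * 1)) + (0 * (0 * (0 * 1)) + (suc m * (suc m * (suc m * 1)) + 0)) ≡
                        (2 * m + 1) + (3 * m + 1) * (0 + (3 * m + 1) * suc m)
    cubes≡value = solve-∀

  small-multiple-cycle : ∃ λ c → IsCycle (Scube b) c × All SmallMultipleOf3 c
  small-multiple-cycle =
    bounded-invariant⇒cycle (Scube b) Scube-preserves (λ (_ , _ , n<b^4) → n<b^4) (λ (0<n , _) → 0<n) small-multiple-3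

corollary6p3 : (k : ℕ) → AtLeastCycles 5 (Scube (3 * suc k + 1))
corollary6p3 k =
  (1 ∷ []) ∷ (A ∷ []) ∷ (B ∷ []) ∷ (C ∷ []) ∷ c ∷ [] , refl ,
  isCycle-1 ∷ isCycle-A ∷ isCycle-B ∷ isCycle-C ∷ isCycle-c ∷ [] ,
  (distinct-digits digits-1 digits-A (λ ()) ∷ distinct-digits digits-1 digits-B (λ ()) ∷
   distinct-digits digits-1 digits-C (λ ()) ∷ outside (¬SmallMultipleOf3 refl) ∷ []) ∷
  (distinct-digits digits-A digits-B (λ ()) ∷ distinct-digits digits-A digits-C (λ ()) ∷
   outside (¬SmallMultipleOf3 A%3≡1) ∷ []) ∷
  (distinct-digits digits-B digits-C (λ ()) ∷ outside (¬SmallMultipleOf3 B%3≡2) ∷ []) ∷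
  (outside (¬SmallMultipleOf3 C%3≡2) ∷ []) ∷
  [] ∷ []
  where
  open Base3m+1 k
  -- Projections rather than a with-pattern: abstracting over the cycle would normalise the
  -- goal, unfolding Scube on symbolic arguments.
  c : List ℕ
  c = proj₁ small-multiple-cycle
  isCycle-c : IsCycle (Scube b) c
  isCycle-c = proj₁ (proj₂ small-multiple-cycle)
  outside : ∀ {u} → ¬ SmallMultipleOf3 u → ¬ SameCycle (u ∷ []) c
  outside ¬u = fixed-point-outside ¬u (proj₂ (proj₂ small-multiple-cycle))
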